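{- Let $G=(A,R,C)$ be an abstract dialectical framework and $F=(A,R,f_Q)$ a may-must argumentation with $F\in\Delta[G]$. Then for every $a\in A$ and every $\lambda\in\Lambda^{\mathrm{pre}(a)}$: (1) $\lambda$ designates $C_a(\lambda)$ for $a$ in $F$; (2) if $l\in\mathcal{L}$ is such that $\lambda$ designates $l$ and no other label for $a$ in $F$, then $\lambda$ designates $l$ for $a$ in $G$, i.e. $C_a(\lambda)=l$.
   Context: Labels: $\mathcal{L}=\{\mathsf{in},\mathsf{out},\mathsf{undec}\}$. For a finite set $S$ of arguments, $\Lambda^S$ is the set of total functions $S\to\mathcal{L}$. A nuance tuple is $((n_1,n_2),(m_1,m_2))\in\mathbb{N}^4$ with $n_1\le n_2$, $m_1\le m_2$. A may-must argumentation (MMA) is $(A,R,f_Q)$ with $A$ finite, $R\subseteq A\times A$, $f_Q$ assigning a nuance tuple to each argument. $\mathrm{pre}(a)=\{b\in A:(b,a)\in R\}$. For $\lambda$ a labelling, $o_\lambda(a)$ (resp. $i_\lambda(a)$) is the number of $b\in\mathrm{pre}(a)$ with $\lambda(b)=\mathsf{out}$ (resp. $\mathsf{in}$). With $f_Q(a)=((n_1,n_2),(m_1,m_2))$: may-a iff $n_1\le o_\lambda(a)$; must-a iff $n_2\le o_\lambda(a)$; may$_s$-a iff $n_1\le o_\lambda(a)<n_2$; not-a iff $o_\lambda(a)<n_1$; may-r, must-r, may$_s$-r, not-r likewise with $m_1,m_2,i_\lambda(a)$. $\lambda$ designates $l$ for $a$ in the MMA iff $\lambda$ is defined on all of $\mathrm{pre}(a)$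 and: $l=\mathsf{in}$ requires may-a and not must-r; $l=\mathsf{out}$ requires may-r and not must-a; $l=\mathsf{undec}$ requires (must-a and must-r) or may$_s$-a or may$_s$-r or (not-a and not-r). An abstract dialectical framework (ADF) is $(A,R,C)$ with $C=(C_a)_{a\in A}$, $C_a:\Lambda^{\mathrm{pre}(a)}\to\mathcal{L}$; a labelling $\lambda$ designates $l$ for $a$ in the ADF iff $\lambda$ is defined on $\mathrm{pre}(a)$ and $C_a(\lambda|_{\mathrm{pre}(a)})=l$. $\Delta[G]$ (abstractions of an ADF $G=(A,R,C)$): all MMAs $(A,R,f_Q)$ such that for every $a\in A$, with $f_Q(a)=((n_1,n_2),(m_1,m_2))$, $n_2\le|\mathrm{pre}(a)|+1$, $m_2\le|\mathrm{pre}(a)|+1$, and for every $\lambda\in\Lambda^{\mathrm{pre}(a)}$, with $o=o_\lambda(a),i=i_\lambda(a)$: $o<n_1,i<m_1\Rightarrow C_a(\lambda)=\mathsf{undec}$; $n_1\le o<n_2,i<m_1\Rightarrow C_a(\lambda)\in\{\mathsf{in},\mathsf{undec}\}$; $n_2\le o,i<m_1\Rightarrow C_a(\lambda)=\mathsf{in}$; $o<n_1,m_1\le i<m_2\Rightarrow C_a(\lambda)\in\{\mathsf{out},\mathsf{undec}\}$; $n_1\le o<n_2,m_1\le i<m_2\Rightarrow C_a(\lambda)$ arbitrary; $n_2\le o,m_1\le i<m_2\Rightarrow C_a(\lambda)\in\{\mathsf{in},\mathsf{undec}\}$; $o<n_1,m_2\le i\Rightarrow C_a(\lambda)=\mathsf{out}$;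 $n_1\le o<n_2,m_2\le i\Rightarrow C_a(\lambda)\in\{\mathsf{out},\mathsf{undec}\}$; $n_2\le o,m_2\le i\Rightarrow C_a(\lambda)=\mathsf{undec}$. -}

module Defs where

open import Data.Nat using (ℕ; zero; suc; _+_; _≤_; _<_)
open import Data.Fin using (Fin)
open import Data.Bool using (Bool; true; false)
open import Data.Product using (_×_; _,_)
open import Data.Sum using (_⊎_)
open import Relation.Nullary using (¬_)
open import Relation.Binary.PropositionalEquality using (_≡_; refl)

data Label : Set where
  lin lout lundec : Label

-- An argument set A is finite: A = Fin k.
-- The attack relation R ⊆ A × A is given as a Boolean-valued (decidable) relation;
-- (b , a) ∈ R  iff  R b a ≡ true.
Rel : ℕ → Set
Rel k = Fin k → Fin k → Bool

-- Λ^{pre(a)}: total functions pre(a) → L, where pre(a) = { b | (b , a) ∈ R }.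
PreLab : {k : ℕ} → Rel k → Fin k → Set
PreLab {k} R a = (b : Fin k) → R b a ≡ true → Label

isLabel : Label → Label → ℕ
isLabel lin lin = 1
isLabel lout lout = 1
isLabel lundec lundec = 1
isLabel _ _ = 0

countPre : {k : ℕ} → (R : Rel k) → (a : Fin k) → PreLab R a → Label → ℕ
countPre {k} R a lam l = go k (λ i → i)
  where
  go : (n : ℕ) → (Fin n → Fin k) → ℕ
  go zero _ = 0
  go (suc n) emb = step (emb Fin.zero) (R (emb Fin.zero) a) refl + go n (λ i → emb (Fin.suc i))
    where
    step : (b : Fin k) → (x : Bool) → R b a ≡ x → ℕ
    step b true eq = isLabel (lam b eq) l
    step b false _ = 0

preSize : {k : ℕ} → Rel k → Fin k → ℕ
preSize {k} R a = go k (λ i → i)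
  where
  go : (n : ℕ) → (Fin n → Fin k) → ℕ
  go zero _ = 0
  go (suc n) emb = b2n (R (emb Fin.zero) a) + go n (λ i → emb (Fin.suc i))
    where
    b2n : Bool → ℕ
    b2n true = 1
    b2n false = 0

record Nuance : Set where
  field
    n₁ n₂ m₁ m₂ : ℕ
    n₁≤n₂ : n₁ ≤ n₂
    m₁≤m₂ : m₁ ≤ m₂
open Nuance public

record MMA (k : ℕ) : Set where
  field
    R  : Rel k
    fQ : Fin k → Nuance
open MMA public

record ADF (k : ℕ) : Set where
  field
    R : Rel k
    C : (a : Fin k) → PreLab R a → Label
open ADF public

module _ {k : ℕ} (R : Rel k) (fQ : Fin k → Nuance) (a : Fin k) (lam : PreLab R a) where
  private
    o = countPre R a lam lout
    i = countPre R a lam lin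
    q = fQ a
  may-a must-a mays-a not-a may-r must-r mays-r not-r : Set
  may-a  = n₁ q ≤ o
  must-a = n₂ q ≤ o
  mays-a = (n₁ q ≤ o) × (o < n₂ q)
  not-a  = o < n₁ q
  may-r  = m₁ q ≤ i
  must-r = m₂ q ≤ i
  mays-r = (m₁ q ≤ i) × (i < m₂ q)
  not-r  = i < m₁ q

  -- λ ∈ Λ^{pre(a)} is defined on all of pre(a) by construction
  Designates : Label → Set
  Designates lin    = may-a × ¬ must-r
  Designates lout   = may-r × ¬ must-a
  Designates lundec = (must-a × must-r) ⊎ mays-a ⊎ mays-r ⊎ (not-a × not-r)

DesignatesMMA : {k : ℕ} → (F : MMA k) → (a : Fin k) → PreLab (R F) a → Label → Set
DesignatesMMA F a lam l = Designates (R F) (fQ F) a lam l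

DesignatesADF : {k : ℕ} → (G : ADF k) → (a : Fin k) → PreLab (R G) a → Label → Set
DesignatesADF G a lam l = C G a lam ≡ l

InDelta : {k : ℕ} → (F : MMA k) → (G : ADF k) → R F ≡ R G → Set
InDelta {k} record { R = .(R G) ; fQ = fQ' } G refl = Cond
  where
  F = record { R = R G ; fQ = fQ' }
  Cond : Set
  Cond = (a : Fin k) → (n₂ (fQ F a) ≤ suc (preSize (R G) a)) × (m₂ (fQ F a) ≤ suc (preSize (R G) a)) ×
    ((lam : PreLab (R G) a) →
      let o = countPre (R G) a lam lout
          i = countPre (R G) a lam lin
          c = C G a lam
          q = fQ F a
      in (o < n₁ q → i < m₁ q → c ≡ lundec)
       × (n₁ q ≤ o → o < n₂ q → i < m₁ q → (c ≡ lin ⊎ c ≡ lundec))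
       × (n₂ q ≤ o → i < m₁ q → c ≡ lin)
       × (o < n₁ q → m₁ q ≤ i → i < m₂ q → (c ≡ lout ⊎ c ≡ lundec))
       × (n₂ q ≤ o → m₁ q ≤ i → i < m₂ q → (c ≡ lin ⊎ c ≡ lundec))
       × (o < n₁ q → m₂ q ≤ i → c ≡ lout)
       × (n₁ q ≤ o → o < n₂ q → m₂ q ≤ i → (c ≡ lout ⊎ c ≡ lundec))
       × (n₂ q ≤ o → m₂ q ≤ i → c ≡ lundec))

mkMMA : {k : ℕ} → ADF k → (Fin k → Nuance) → MMA k
mkMMA G fQ' = record { R = R G ; fQ = fQ' }

-- The compatibility table defining Δ[G] is a 3×3 grid indexed by where the number o of
-- out-labelled attackers lies relative to n₁ ≤ n₂ and where the number i of in-labelled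
-- attackers lies relative to m₁ ≤ m₂. In every cell the labels the table allows for C_a(λ)
-- are exactly labels that λ designates in F, so C_a(λ) is always designated. If λ designates
-- only l, then C_a(λ), being designated, must be l.
module Submission where

open import Defs
open import Data.Nat using (ℕ; _≤_; _<_; _≤?_)
open import Data.Nat.Properties using (≤-trans; <-≤-trans; ≰⇒>; <⇒≱)
open import Data.Fin using (Fin)
open import Data.Product using (_×_; _,_; proj₂)
open import Data.Sum using (_⊎_; inj₁; inj₂)
open import Relation.Nullary using (¬_; yes; no)
open import Relation.Nullary.Decidable using (decidable-stable)
open import Relation.Binary.Definitions using (DecidableEquality)
open import Relation.Binary.PropositionalEquality using (_≡_; _≢_; refl; sym; subst)

_≟_ : DecidableEquality Label
lin    ≟ lin    = yes refl
lout   ≟ lout   = yes refl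
lundec ≟ lundec = yes refl
lin    ≟ lout   = no λ ()
lin    ≟ lundec = no λ ()
lout   ≟ lin    = no λ ()
lout   ≟ lundec = no λ ()
lundec ≟ lin    = no λ ()
lundec ≟ lout   = no λ ()

data Position (lo hi x : ℕ) : Set where
  below   : x < lo → Position lo hi x
  between : lo ≤ x → x < hi → Position lo hi x
  above   : hi ≤ x → Position lo hi x

position : ∀ {lo hi} x → Position lo hi x
position {lo} {hi} x with hi ≤? x | lo ≤? x
... | yes hi≤x | _        = above hi≤x
... | no  hi≰x | yes lo≤x = between lo≤x (≰⇒> hi≰x)
... | no  _    | no  lo≰x = below (≰⇒> lo≰x)

Designated : Nuance → (o i : ℕ) → Label → Set
Designated q o i lin    = (n₁ q ≤ o) × ¬ (m₂ q ≤ i)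
Designated q o i lout   = (m₁ q ≤ i) × ¬ (n₂ q ≤ o)
Designated q o i lundec = ((n₂ q ≤ o) × (m₂ q ≤ i)) ⊎ ((n₁ q ≤ o) × (o < n₂ q))
                          ⊎ ((m₁ q ≤ i) × (i < m₂ q)) ⊎ ((o < n₁ q) × (i < m₁ q))

designates-counts : ∀ {k} (R : Rel k) (fQ : Fin k → Nuance) (a : Fin k) (lam : PreLab R a) l →
  Designated (fQ a) (countPre R a lam lout) (countPre R a lam lin) l → Designates R fQ a lam l
designates-counts R fQ a lam lin    d = d
designates-counts R fQ a lam lout   d = d
designates-counts R fQ a lam lundec d = d

Compatible : Nuance → (o i : ℕ) → Label → Set
Compatible q o i c =
     (o < n₁ q → i < m₁ q → c ≡ lundec)
   × (n₁ q ≤ o → o < n₂ q → i < m₁ q → (c ≡ lin ⊎ c ≡ lundec))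
   × (n₂ q ≤ o → i < m₁ q → c ≡ lin)
   × (o < n₁ q → m₁ q ≤ i → i < m₂ q → (c ≡ lout ⊎ c ≡ lundec))
   × (n₂ q ≤ o → m₁ q ≤ i → i < m₂ q → (c ≡ lin ⊎ c ≡ lundec))
   × (o < n₁ q → m₂ q ≤ i → c ≡ lout)
   × (n₁ q ≤ o → o < n₂ q → m₂ q ≤ i → (c ≡ lout ⊎ c ≡ lundec))
   × (n₂ q ≤ o → m₂ q ≤ i → c ≡ lundec)

one-of : ∀ {P : Label → Set} {c x y} → c ≡ x ⊎ c ≡ y → P x → P y → P c
one-of (inj₁ refl) px _  = px
one-of (inj₂ refl) _  py = py

module _ (q : Nuance) {o i : ℕ} where

  private
    D : Label → Set
    D = Designated q o i

    n₂≤o⇒n₁≤o : n₂ q ≤ o → n₁ q ≤ o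
    n₂≤o⇒n₁≤o = ≤-trans (n₁≤n₂ q)

    m₂≤i⇒m₁≤i : m₂ q ≤ i → m₁ q ≤ i
    m₂≤i⇒m₁≤i = ≤-trans (m₁≤m₂ q)

    o<n₁⇒o<n₂ : o < n₁ q → o < n₂ q
    o<n₁⇒o<n₂ o<n₁ = <-≤-trans o<n₁ (n₁≤n₂ q)

    i<m₁⇒i<m₂ : i < m₁ q → i < m₂ q
    i<m₁⇒i<m₂ i<m₁ = <-≤-trans i<m₁ (m₁≤m₂ q)

  in-designated : n₁ q ≤ o → i < m₂ q → Designated q o i lin
  in-designated n₁≤o i<m₂ = n₁≤o , <⇒≱ i<m₂

  out-designated : m₁ q ≤ i → o < n₂ q → Designated q o i lout
  out-designated m₁≤i o<n₂ = m₁≤i , <⇒≱ o<n₂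

  undec-designated-may-a : n₁ q ≤ o → o < n₂ q → Designated q o i lundec
  undec-designated-may-a n₁≤o o<n₂ = inj₂ (inj₁ (n₁≤o , o<n₂))

  undec-designated-may-r : m₁ q ≤ i → i < m₂ q → Designated q o i lundec
  undec-designated-may-r m₁≤i i<m₂ = inj₂ (inj₂ (inj₁ (m₁≤i , i<m₂)))

  -- In a hypothesis name the first letter places o and the second places i:
  -- n(ot) below the lower bound, s(trictly may) between the bounds, m(ust) above the upper one.
  compatible⇒designated : ∀ {c} → Compatible q o i c → Designated q o i c
  compatible⇒designated {c} (nn , sn , mn , ns , ms , nm , sm , mm)
    with position {n₁ q} {n₂ q} o | position {m₁ q} {m₂ q} i
  ... | below o<n₁ | below i<m₁ =
    subst D (sym (nn o<n₁ i<m₁)) (inj₂ (inj₂ (inj₂ (o<n₁ , i<m₁))))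
  ... | between n₁≤o o<n₂ | below i<m₁ =
    one-of {D} (sn n₁≤o o<n₂ i<m₁)
      (in-designated n₁≤o (i<m₁⇒i<m₂ i<m₁)) (undec-designated-may-a n₁≤o o<n₂)
  ... | above n₂≤o | below i<m₁ =
    subst D (sym (mn n₂≤o i<m₁)) (in-designated (n₂≤o⇒n₁≤o n₂≤o) (i<m₁⇒i<m₂ i<m₁))
  ... | below o<n₁ | between m₁≤i i<m₂ =
    one-of {D} (ns o<n₁ m₁≤i i<m₂)
      (out-designated m₁≤i (o<n₁⇒o<n₂ o<n₁)) (undec-designated-may-r m₁≤i i<m₂)
  ... | between n₁≤o o<n₂ | between m₁≤i i<m₂ = any-label c
    where
    any-label : ∀ l → D l
    any-label lin    = in-designated n₁≤o i<m₂
    any-label lout   = out-designated m₁≤i o<n₂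
    any-label lundec = undec-designated-may-a n₁≤o o<n₂
  ... | above n₂≤o | between m₁≤i i<m₂ =
    one-of {D} (ms n₂≤o m₁≤i i<m₂)
      (in-designated (n₂≤o⇒n₁≤o n₂≤o) i<m₂) (undec-designated-may-r m₁≤i i<m₂)
  ... | below o<n₁ | above m₂≤i =
    subst D (sym (nm o<n₁ m₂≤i)) (out-designated (m₂≤i⇒m₁≤i m₂≤i) (o<n₁⇒o<n₂ o<n₁))
  ... | between n₁≤o o<n₂ | above m₂≤i =
    one-of {D} (sm n₁≤o o<n₂ m₂≤i)
      (out-designated (m₂≤i⇒m₁≤i m₂≤i) o<n₂) (undec-designated-may-a n₁≤o o<n₂)
  ... | above n₂≤o | above m₂≤i =
    subst D (sym (mm n₂≤o m₂≤i)) (inj₁ (n₂≤o , m₂≤i))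

only-label : ∀ {P : Label → Set} {c l} → P c → (∀ l′ → l′ ≢ l → ¬ P l′) → c ≡ l
only-label {c = c} {l} pc others = decidable-stable (c ≟ l) λ c≢l → others c c≢l pc

mainTheorem5 : {k : ℕ} (G : ADF k) (fQ' : Fin k → Nuance) →
    InDelta (mkMMA G fQ') G refl →
    (a : Fin k) (lam : PreLab (R G) a) →
      DesignatesMMA (mkMMA G fQ') a lam (C G a lam)
      × ((l : Label) → DesignatesMMA (mkMMA G fQ') a lam l →
           ((l' : Label) → ¬ (l' ≡ l) → ¬ DesignatesMMA (mkMMA G fQ') a lam l') →
           DesignatesADF G a lam l)
mainTheorem5 G fQ' Δ a lam = C-designated , λ l _ others → only-label C-designated others
  where
  C-designated : DesignatesMMA (mkMMA G fQ') a lam (C G a lam)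
  C-designated = designates-counts (R G) fQ' a lam (C G a lam)
    (compatible⇒designated (fQ' a) (proj₂ (proj₂ (Δ a)) lam))
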